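{- If $T$ is a spanning tree of $G$ and $\tilde e_T:=\sum_{y_i\in E(T)}(v_i,1)+e_{n+1}$, then $\tilde e_T\in\mathbb{N}B\cap(\mathbb{R}_+B)^\circ$.
   Context: $G$ is a connected simple graph with $V(G)=\{x_1,\dots,x_n\}$, $E(G)=\{y_1,\dots,y_q\}\neq\emptyset$; $e_1,\dots,e_n$ is the canonical basis of $\mathbb{R}^n$, $v_k=e_i+e_j$ the characteristic vector of $y_k=\{x_i,x_j\}$, $e_{n+1}=(0,\dots,0,1)\in\mathbb{R}^{n+1}$, $B=\{(e_1,1),\dots,(e_n,1),(v_1,1),\dots,(v_q,1),e_{n+1}\}$, $\mathbb{N}B$ the set of nonnegative integer combinations of $B$, $\mathbb{R}_+B$ the cone of nonnegative real combinations, and $(\mathbb{R}_+B)^\circ$ its interior in $\mathbb{R}^{n+1}$.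
   Formalization: The space ℝ^(n+1) is replaced by ℚ^(n+1): the cone $\mathbb{R}_+B$ consists of rational points with nonnegative rational coefficients, and its interior is tested on rational points of rational ε-boxes. -}

module Defs where

open import Data.Nat as ℕ using (ℕ; zero; suc)
open import Data.Fin using (Fin; zero; suc; inject₁; fromℕ; _≟_)
open import Data.Fin.Subset using (Subset)
open import Data.Vec using (lookup)
open import Data.Bool using (Bool; true; false; if_then_else_)
open import Data.Product using (Σ; ∃; _×_; _,_; proj₁; proj₂)
open import Data.Sum using (_⊎_)
open import Relation.Binary.PropositionalEquality using (_≡_; _≢_)
open import Relation.Nullary using (does; ¬_)
open import Function.Definitions using (Injective)
open import Data.Rational using (ℚ; 0ℚ; 1ℚ; _+_; _*_; _-_; ∣_∣; _≤_; _<_)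
import Data.Integer as ℤ

SameEdge : ∀ {n} → Fin n × Fin n → Fin n × Fin n → Set
SameEdge (a , b) (c , d) = (a ≡ c × b ≡ d) ⊎ (a ≡ d × b ≡ c)

record Graph (n q : ℕ) : Set where
  field
    ends     : Fin q → Fin n × Fin n
    loopless : ∀ k → proj₁ (ends k) ≢ proj₂ (ends k)
    noMulti  : ∀ k l → SameEdge (ends k) (ends l) → k ≡ l
open Graph public

Adj : ∀ {n q} → Graph n q → Subset q → Fin n → Fin n → Set
Adj G S u v = ∃ λ k → lookup S k ≡ true × SameEdge (ends G k) (u , v)

data Walk {n q} (G : Graph n q) (S : Subset q) : Fin n → Fin n → Set where
  here : ∀ {u} → Walk G S u u
  step : ∀ {u v w} → Adj G S u v → Walk G S v w → Walk G S u w

ConnectedOn : ∀ {n q} → Graph n q → Subset q → Set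
ConnectedOn G S = ∀ u v → Walk G S u v

-- a cycle in (V(G), S): distinct vertices c_0 … c_{m+2} (length ≥ 3),
-- consecutive ones adjacent, and c_{m+2} adjacent to c_0
Cycle : ∀ {n q} → Graph n q → Subset q → Set
Cycle {n} G S =
  Σ ℕ λ m → Σ (Fin (suc (suc (suc m))) → Fin n) λ c →
    Injective _≡_ _≡_ c
    × (∀ (i : Fin (suc (suc m))) → Adj G S (c (inject₁ i)) (c (suc i)))
    × Adj G S (c (fromℕ (suc (suc m)))) (c zero)

Acyclic : ∀ {n q} → Graph n q → Subset q → Set
Acyclic G S = ¬ Cycle G S

Connected : ∀ {n q} → Graph n q → Set
Connected {q = q} G = ConnectedOn G (Data.Fin.Subset.⊤)

IsSpanningTree : ∀ {n q} → Graph n q → Subset q → Set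
IsSpanningTree G S = ConnectedOn G S × Acyclic G S

-- Vectors over ℚ (rational points of ℝ^{n+1})

Vecℚ : ℕ → Set
Vecℚ m = Fin m → ℚ

ℕtoℚ : ℕ → ℚ
ℕtoℚ k = ℤ.+ k Data.Rational./ 1

sumFin : ∀ {m} → (Fin m → ℚ) → ℚ
sumFin {zero}  f = 0ℚ
sumFin {suc m} f = f zero + sumFin (λ i → f (suc i))

-- (w , a) ∈ ℚ^{n+1}, the last coordinate being index fromℕ n
snoc : ∀ {n} → Vecℚ n → ℚ → Vecℚ (suc n)
snoc {zero}  w a zero    = a
snoc {suc n} w a zero    = w zero
snoc {suc n} w a (suc i) = snoc (λ j → w (suc j)) a i

e : ∀ {n} → Fin n → Vecℚ n
e i j = if does (i ≟ j) then 1ℚ else 0ℚ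

vchar : ∀ {n q} → Graph n q → Fin q → Vecℚ n
vchar G k j = e (proj₁ (ends G k)) j + e (proj₂ (ends G k)) j

eLast : ∀ n → Vecℚ (suc n)
eLast n = snoc (λ _ → 0ℚ) 1ℚ

comb : ∀ {n q} → Graph n q → (Fin n → ℚ) → (Fin q → ℚ) → ℚ → Vecℚ (suc n)
comb {n} G λ′ μ ν j =
  sumFin (λ i → λ′ i * snoc (e i) 1ℚ j)
  + sumFin (λ k → μ k * snoc (vchar G k) 1ℚ j)
  + ν * eLast n j

InNB : ∀ {n q} → Graph n q → Vecℚ (suc n) → Set
InNB {n} {q} G x = Σ (Fin n → ℕ) λ λ′ → Σ (Fin q → ℕ) λ μ → Σ ℕ λ ν →
  ∀ j → x j ≡ comb G (λ i → ℕtoℚ (λ′ i)) (λ k → ℕtoℚ (μ k)) (ℕtoℚ ν) j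

-- x ∈ ℝ₊B (rational points, nonnegative rational coefficients)
InCone : ∀ {n q} → Graph n q → Vecℚ (suc n) → Set
InCone {n} {q} G x = Σ (Fin n → ℚ) λ λ′ → Σ (Fin q → ℚ) λ μ → Σ ℚ λ ν →
  (∀ i → 0ℚ ≤ λ′ i) × (∀ k → 0ℚ ≤ μ k) × (0ℚ ≤ ν)
  × (∀ j → x j ≡ comb G λ′ μ ν j)

InInterior : ∀ {n q} → Graph n q → Vecℚ (suc n) → Set
InInterior {n} G x = Σ ℚ λ ε → (0ℚ < ε) ×
  (∀ (y : Vecℚ (suc n)) → (∀ j → ∣ y j - x j ∣ < ε) → InCone G y)

eTilde : ∀ {n q} → Graph n q → Subset q → Vecℚ (suc n)
eTilde {n} G S j =
  sumFin (λ k → if lookup S k then snoc (vchar G k) 1ℚ j else 0ℚ) + eLast n j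

{-# OPTIONS --safe #-}
-- With d the degree vector of T, ẽ_T = (d, |E(T)| + 1) is the sum of the generators (v_k,1),
-- y_k ∈ E(T), and e_{n+1}.  Because T is connected and G has an edge, d_i ≥ 1 for every vertex.
-- A point y within ε of ẽ_T is then a nonnegative combination: coefficient 1 - ε on each (v_k,1)
-- with y_k ∈ E(T), y_i - (1 - ε) d_i ≥ ε (d_i - 1) ≥ 0 on (e_i,1), and the rest of the last
-- coordinate on e_{n+1}, which by the handshake identity Σ d_i = 2 |E(T)| is nonnegative as soon
-- as ε (1 + n + |E(T)|) = 1.
module Submission where

open import Defs
open import Data.Nat using (ℕ; zero; suc; _≤_; s≤s; z≤n)
open import Data.Fin using (Fin; zero; suc; inject₁; fromℕ; _≟_)
open import Data.Fin.Subset using (Subset)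
open import Data.Vec using (lookup)
open import Data.Bool using (true; false; if_then_else_)
open import Data.Product using (Σ; ∃; _×_; _,_; proj₁; proj₂)
open import Data.Sum using (_⊎_; inj₁; inj₂)
open import Data.Empty using (⊥-elim)
open import Function using (_∘_)
open import Relation.Nullary using (does; yes; no)
open import Relation.Nullary.Decidable using (dec-true)
open import Relation.Binary.PropositionalEquality
open import Data.Rational
  using (ℚ; 0ℚ; 1ℚ; _+_; _*_; _-_; -_; ∣_∣; 1/_; Positive; NonZero; positive; nonNegative)
  renaming (_≤_ to _≤ℚ_; _<_ to _<ℚ_)
open import Data.Rational.Properties
  using ( ≤-refl; ≤-reflexive; ≤-trans; ≤-total; <⇒≤; module ≤-Reasoning
        ; +-identityˡ; +-identityʳ; +-inverseʳ; +-comm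
        ; *-identityˡ; *-identityʳ; *-zeroˡ; *-zeroʳ; *-assoc; *-distribˡ-+
        ; +-mono-≤; +-monoˡ-≤; +-monoʳ-≤; *-monoˡ-≤-nonNeg; neg-antimono-≤
        ; positive⁻¹; nonNegative⁻¹; normalize-nonNeg; nonNeg*nonNeg⇒nonNeg; pos+nonNeg⇒pos
        ; pos⇒nonZero; 1/pos⇒pos; *-inverseˡ; 0≤∣p∣; 0≤p⇒∣p∣≡p; ∣-p∣≡∣p∣ )
open import Data.Rational.Solver using (module +-*-Solver)
open +-*-Solver using (solve; _:+_; _:*_; _:-_; :-_; con; _:=_)

ℕtoℚ-nonneg : ∀ m → 0ℚ ≤ℚ ℕtoℚ m
ℕtoℚ-nonneg m = nonNegative⁻¹ _ {{normalize-nonNeg m 1}}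

*-nonneg : ∀ {p q} → 0ℚ ≤ℚ p → 0ℚ ≤ℚ q → 0ℚ ≤ℚ p * q
*-nonneg {p} {q} 0≤p 0≤q =
  nonNegative⁻¹ _ {{nonNeg*nonNeg⇒nonNeg p {{nonNegative 0≤p}} q {{nonNegative 0≤q}}}}

p≤p+q : ∀ p {q} → 0ℚ ≤ℚ q → p ≤ℚ p + q
p≤p+q p {q} 0≤q = subst (_≤ℚ p + q) (+-identityʳ p) (+-monoʳ-≤ p 0≤q)

p≤q⇒0≤q-p : ∀ {p q} → p ≤ℚ q → 0ℚ ≤ℚ q - p
p≤q⇒0≤q-p {p} {q} p≤q =
  subst (_≤ℚ q - p) (+-inverseʳ p) (+-monoˡ-≤ (- p) p≤q)

p≤∣p∣ : ∀ p → p ≤ℚ ∣ p ∣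
p≤∣p∣ p with ≤-total 0ℚ p
... | inj₁ 0≤p = ≤-reflexive (sym (0≤p⇒∣p∣≡p 0≤p))
... | inj₂ p≤0 = ≤-trans p≤0 (0≤∣p∣ p)

∣p-q∣<ε⇒p≤q+ε : ∀ {p q ε} → ∣ p - q ∣ <ℚ ε → p ≤ℚ q + ε
∣p-q∣<ε⇒p≤q+ε {p} {q} {ε} h = begin
  p             ≡⟨ solve 2 (λ p q → p := q :+ (p :- q)) refl p q ⟩
  q + (p - q)   ≤⟨ +-monoʳ-≤ q (p≤∣p∣ (p - q)) ⟩
  q + ∣ p - q ∣ ≤⟨ +-monoʳ-≤ q (<⇒≤ h) ⟩
  q + ε         ∎
  where open ≤-Reasoning

∣p-q∣<ε⇒q-ε≤p : ∀ {p q ε} → ∣ p - q ∣ <ℚ ε → q - ε ≤ℚ p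
∣p-q∣<ε⇒q-ε≤p {p} {q} {ε} h = begin
  q - ε                  ≡⟨ solve 3 (λ p q ε → q :- ε := (p :+ (:- (p :- q))) :- ε) refl p q ε ⟩
  p + - (p - q) - ε      ≤⟨ +-monoˡ-≤ (- ε) (+-monoʳ-≤ p (p≤∣p∣ (- (p - q)))) ⟩
  p + ∣ - (p - q) ∣ - ε  ≡⟨ cong (λ z → p + z - ε) (∣-p∣≡∣p∣ (p - q)) ⟩
  p + ∣ p - q ∣ - ε      ≤⟨ +-monoˡ-≤ (- ε) (+-monoʳ-≤ p (<⇒≤ h)) ⟩
  p + ε - ε              ≡⟨ solve 2 (λ p ε → p :+ ε :- ε := p) refl p ε ⟩
  p                      ∎
  where open ≤-Reasoning

[1-ε]*d≤d-ε : ∀ {ε d} → 0ℚ ≤ℚ ε → 1ℚ ≤ℚ d → (1ℚ - ε) * d ≤ℚ d - ε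
[1-ε]*d≤d-ε {ε} {d} 0≤ε 1≤d = begin
  (1ℚ - ε) * d   ≡⟨ solve 2 (λ ε d → (con 1ℚ :- ε) :* d := d :- ε :* d) refl ε d ⟩
  d - ε * d      ≤⟨ +-monoʳ-≤ d (neg-antimono-≤ (*-monoˡ-≤-nonNeg ε {{nonNegative 0≤ε}} 1≤d)) ⟩
  d - ε * 1ℚ     ≡⟨ cong (λ z → d - z) (*-identityʳ ε) ⟩
  d - ε          ∎
  where open ≤-Reasoning

inverse-of-1+nonneg : ∀ r → 0ℚ ≤ℚ r → ∃ λ ε → 0ℚ <ℚ ε × ε * (1ℚ + r) ≡ 1ℚ
inverse-of-1+nonneg r 0≤r =
  1/ (1ℚ + r) , positive⁻¹ _ {{1/pos⇒pos (1ℚ + r)}} , *-inverseˡ (1ℚ + r)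
  where
  instance
    1+r-positive : Positive (1ℚ + r)
    1+r-positive = pos+nonNeg⇒pos 1ℚ r {{nonNegative 0≤r}}
    1+r-nonZero : NonZero (1ℚ + r)
    1+r-nonZero = pos⇒nonZero (1ℚ + r)

sumFin-cong : ∀ {m} {f g : Fin m → ℚ} → f ≗ g → sumFin f ≡ sumFin g
sumFin-cong {zero}  f≗g = refl
sumFin-cong {suc m} f≗g = cong₂ _+_ (f≗g zero) (sumFin-cong (f≗g ∘ suc))

sumFin-0 : ∀ m → sumFin {m} (λ _ → 0ℚ) ≡ 0ℚ
sumFin-0 zero    = refl
sumFin-0 (suc m) = trans (+-identityˡ _) (sumFin-0 m)

sumFin-+ : ∀ {m} (f g : Fin m → ℚ) → sumFin (λ i → f i + g i) ≡ sumFin f + sumFin g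
sumFin-+ {zero}  f g = refl
sumFin-+ {suc m} f g =
  trans (cong (f zero + g zero +_) (sumFin-+ (f ∘ suc) (g ∘ suc)))
        (solve 4 (λ a b c d → (a :+ b) :+ (c :+ d) := (a :+ c) :+ (b :+ d)) refl
               (f zero) (g zero) (sumFin (f ∘ suc)) (sumFin (g ∘ suc)))

sumFin-*ˡ : ∀ {m} c (f : Fin m → ℚ) → sumFin (λ i → c * f i) ≡ c * sumFin f
sumFin-*ˡ {zero}  c f = sym (*-zeroʳ c)
sumFin-*ˡ {suc m} c f =
  trans (cong (c * f zero +_) (sumFin-*ˡ c (f ∘ suc))) (sym (*-distribˡ-+ c _ _))

sumFin-- : ∀ {m} (f g : Fin m → ℚ) → sumFin (λ i → f i - g i) ≡ sumFin f - sumFin g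
sumFin-- f g = begin
  sumFin (λ i → f i - g i)             ≡⟨ sumFin-+ f (-_ ∘ g) ⟩
  sumFin f + sumFin (λ i → - g i)      ≡⟨ cong (sumFin f +_) (sumFin-cong (λ i → neg≡-1* (g i))) ⟩
  sumFin f + sumFin (λ i → - 1ℚ * g i) ≡⟨ cong (sumFin f +_) (sumFin-*ˡ (- 1ℚ) g) ⟩
  sumFin f + - 1ℚ * sumFin g           ≡⟨ cong (sumFin f +_) (sym (neg≡-1* (sumFin g))) ⟩
  sumFin f - sumFin g                  ∎
  where
  open ≡-Reasoning
  neg≡-1* : ∀ p → - p ≡ - 1ℚ * p
  neg≡-1* = solve 1 (λ p → :- p := con (- 1ℚ) :* p) refl

sumFin-const : ∀ {m} c → sumFin {m} (λ _ → c) ≡ c * sumFin {m} (λ _ → 1ℚ)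
sumFin-const {m} c =
  trans (sumFin-cong {m} (λ _ → sym (*-identityʳ c))) (sumFin-*ˡ {m} c (λ _ → 1ℚ))

sumFin-swap : ∀ {m p} (f : Fin m → Fin p → ℚ) →
  sumFin (λ i → sumFin (f i)) ≡ sumFin (λ k → sumFin (λ i → f i k))
sumFin-swap {zero}  {p} f = sym (sumFin-0 p)
sumFin-swap {suc m}     f =
  trans (cong (sumFin (f zero) +_) (sumFin-swap (f ∘ suc)))
        (sym (sumFin-+ (f zero) (λ k → sumFin (λ i → f (suc i) k))))

sumFin-mono : ∀ {m} {f g : Fin m → ℚ} → (∀ i → f i ≤ℚ g i) → sumFin f ≤ℚ sumFin g
sumFin-mono {zero}  f≤g = ≤-refl
sumFin-mono {suc m} f≤g = +-mono-≤ (f≤g zero) (sumFin-mono (f≤g ∘ suc))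

sumFin-nonneg : ∀ {m} {f : Fin m → ℚ} → (∀ i → 0ℚ ≤ℚ f i) → 0ℚ ≤ℚ sumFin f
sumFin-nonneg {m} {f} 0≤f = subst (_≤ℚ sumFin f) (sumFin-0 m) (sumFin-mono 0≤f)

0≤sumFin-1 : ∀ m → 0ℚ ≤ℚ sumFin {m} (λ _ → 1ℚ)
0≤sumFin-1 m = sumFin-nonneg {m} (λ _ → <⇒≤ (positive⁻¹ 1ℚ))

term≤sumFin : ∀ {m} {f : Fin m → ℚ} → (∀ i → 0ℚ ≤ℚ f i) → ∀ k → f k ≤ℚ sumFin f
term≤sumFin {suc m} {f} 0≤f zero = p≤p+q (f zero) (sumFin-nonneg (0≤f ∘ suc))
term≤sumFin {suc m} {f} 0≤f (suc k) =
  subst (_≤ℚ sumFin f) (+-identityˡ (f (suc k))) (+-mono-≤ (0≤f zero) (term≤sumFin (0≤f ∘ suc) k))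

e-diag : ∀ {m} (t : Fin m) → e t t ≡ 1ℚ
e-diag t = cong (if_then 1ℚ else 0ℚ) (dec-true (t ≟ t) refl)

e-nonneg : ∀ {m} (a t : Fin m) → 0ℚ ≤ℚ e a t
e-nonneg a t with does (a ≟ t)
... | true  = <⇒≤ (positive⁻¹ 1ℚ)
... | false = ≤-refl

sumFin-e : ∀ {m} (a : Fin m) → sumFin (e a) ≡ 1ℚ
sumFin-e {suc m} zero    = trans (cong (1ℚ +_) (sumFin-0 m)) (+-identityʳ 1ℚ)
sumFin-e {suc m} (suc a) = trans (+-identityˡ _) (sumFin-e a)

sumFin-*e : ∀ {m} (f : Fin m → ℚ) t → sumFin (λ i → f i * e i t) ≡ f t
sumFin-*e {suc m} f zero =
  trans (cong₂ _+_ (*-identityʳ (f zero))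
                   (trans (sumFin-cong (λ i → *-zeroʳ (f (suc i)))) (sumFin-0 m)))
        (+-identityʳ (f zero))
sumFin-*e {suc m} f (suc t) =
  trans (cong₂ _+_ (*-zeroʳ (f zero)) (sumFin-*e (f ∘ suc) t)) (+-identityˡ (f (suc t)))

snoc-inject₁ : ∀ {n} (w : Vecℚ n) a t → snoc w a (inject₁ t) ≡ w t
snoc-inject₁ {suc n} w a zero    = refl
snoc-inject₁ {suc n} w a (suc t) = snoc-inject₁ (w ∘ suc) a t

snoc-fromℕ : ∀ {n} (w : Vecℚ n) a → snoc w a (fromℕ n) ≡ a
snoc-fromℕ {zero}  w a = refl
snoc-fromℕ {suc n} w a = snoc-fromℕ (w ∘ suc) a

≗-from-inject₁-fromℕ : ∀ {n} {x y : Vecℚ (suc n)} →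
  x ∘ inject₁ ≗ y ∘ inject₁ → x (fromℕ n) ≡ y (fromℕ n) → x ≗ y
≗-from-inject₁-fromℕ {zero}          _    last zero    = last
≗-from-inject₁-fromℕ {suc n}         init _    zero    = init zero
≗-from-inject₁-fromℕ {suc n} {x} {y} init last (suc j) =
  ≗-from-inject₁-fromℕ {n} {x ∘ suc} {y ∘ suc} (init ∘ suc) last j

𝟙 : ∀ {q} → Subset q → Fin q → ℕ
𝟙 S k = if lookup S k then 1 else 0

if-then-else-0 : ∀ b z → (if b then z else 0ℚ) ≡ ℕtoℚ (if b then 1 else 0) * z
if-then-else-0 true  z = sym (*-identityˡ z)
if-then-else-0 false z = sym (*-zeroˡ z)

interior-resp-≗ : ∀ {n q} (G : Graph n q) {x x′ : Vecℚ (suc n)} →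
  x ≗ x′ → InInterior G x → InInterior G x′
interior-resp-≗ G x≗x′ (ε , 0<ε , ball⊆cone) =
  ε , 0<ε , λ y near →
    ball⊆cone y (λ j → subst (λ z → ∣ y j - z ∣ <ℚ ε) (sym (x≗x′ j)) (near j))

module _ {n q} (G : Graph n q) where

  degree : (Fin q → ℚ) → Fin n → ℚ
  degree μ t = sumFin (λ k → μ k * vchar G k t)

  comb-inject₁ : ∀ λ′ μ ν t → comb G λ′ μ ν (inject₁ t) ≡ λ′ t + degree μ t
  comb-inject₁ λ′ μ ν t = begin
    comb G λ′ μ ν (inject₁ t)
      ≡⟨ cong₂ (λ a b → a + b + ν * eLast n (inject₁ t))
               (sumFin-cong (λ i → cong (λ′ i *_) (snoc-inject₁ (e i) 1ℚ t)))
               (sumFin-cong (λ k → cong (μ k *_) (snoc-inject₁ (vchar G k) 1ℚ t))) ⟩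
    sumFin (λ i → λ′ i * e i t) + degree μ t + ν * eLast n (inject₁ t)
      ≡⟨ cong₂ (λ a b → a + degree μ t + ν * b) (sumFin-*e λ′ t) (snoc-inject₁ (λ _ → 0ℚ) 1ℚ t) ⟩
    λ′ t + degree μ t + ν * 0ℚ
      ≡⟨ solve 3 (λ l d ν → l :+ d :+ ν :* con 0ℚ := l :+ d) refl (λ′ t) (degree μ t) ν ⟩
    λ′ t + degree μ t ∎
    where open ≡-Reasoning

  comb-fromℕ : ∀ λ′ μ ν → comb G λ′ μ ν (fromℕ n) ≡ sumFin λ′ + sumFin μ + ν
  comb-fromℕ λ′ μ ν = begin
    comb G λ′ μ ν (fromℕ n)
      ≡⟨ cong₂ (λ a b → a + b + ν * eLast n (fromℕ n))
               (sumFin-cong (λ i → cong (λ′ i *_) (snoc-fromℕ (e i) 1ℚ)))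
               (sumFin-cong (λ k → cong (μ k *_) (snoc-fromℕ (vchar G k) 1ℚ))) ⟩
    sumFin (λ i → λ′ i * 1ℚ) + sumFin (λ k → μ k * 1ℚ) + ν * eLast n (fromℕ n)
      ≡⟨ cong₂ (λ a b → a + b + ν * eLast n (fromℕ n))
               (sumFin-cong (*-identityʳ ∘ λ′)) (sumFin-cong (*-identityʳ ∘ μ)) ⟩
    sumFin λ′ + sumFin μ + ν * eLast n (fromℕ n)
      ≡⟨ cong (λ z → sumFin λ′ + sumFin μ + ν * z) (snoc-fromℕ {n} (λ _ → 0ℚ) 1ℚ) ⟩
    sumFin λ′ + sumFin μ + ν * 1ℚ
      ≡⟨ cong (sumFin λ′ + sumFin μ +_) (*-identityʳ ν) ⟩
    sumFin λ′ + sumFin μ + ν ∎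
    where open ≡-Reasoning

  degree-*ˡ : ∀ c μ t → degree (λ k → c * μ k) t ≡ c * degree μ t
  degree-*ˡ c μ t =
    trans (sumFin-cong (λ k → *-assoc c (μ k) (vchar G k t)))
          (sumFin-*ˡ c (λ k → μ k * vchar G k t))

  sumFin-vchar : ∀ k → sumFin (vchar G k) ≡ 1ℚ + 1ℚ
  sumFin-vchar k = trans (sumFin-+ (e (proj₁ (ends G k))) (e (proj₂ (ends G k))))
                         (cong₂ _+_ (sumFin-e (proj₁ (ends G k))) (sumFin-e (proj₂ (ends G k))))

  sumFin-degree : ∀ μ → sumFin (degree μ) ≡ sumFin μ + sumFin μ
  sumFin-degree μ = begin
    sumFin (degree μ)                                ≡⟨ sumFin-swap (λ t k → μ k * vchar G k t) ⟩
    sumFin (λ k → sumFin (λ t → μ k * vchar G k t))  ≡⟨ sumFin-cong (λ k → sumFin-*ˡ (μ k) (vchar G k)) ⟩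
    sumFin (λ k → μ k * sumFin (vchar G k))          ≡⟨ sumFin-cong (λ k → cong (μ k *_) (sumFin-vchar k)) ⟩
    sumFin (λ k → μ k * (1ℚ + 1ℚ))                   ≡⟨ sumFin-cong (double ∘ μ) ⟩
    sumFin (λ k → μ k + μ k)                         ≡⟨ sumFin-+ μ μ ⟩
    sumFin μ + sumFin μ                              ∎
    where
    open ≡-Reasoning
    double : ∀ p → p * (1ℚ + 1ℚ) ≡ p + p
    double = solve 1 (λ p → p :* (con 1ℚ :+ con 1ℚ) := p :+ p) refl

  inCone-fromEdgeWeights : ∀ (y : Vecℚ (suc n)) μ → (∀ k → 0ℚ ≤ℚ μ k) →
    (∀ t → degree μ t ≤ℚ y (inject₁ t)) →
    sumFin (y ∘ inject₁) - sumFin μ ≤ℚ y (fromℕ n) →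
    InCone G y
  inCone-fromEdgeWeights y μ 0≤μ degree≤y Σy-Σμ≤y =
    λ′ , μ , ν , (p≤q⇒0≤q-p ∘ degree≤y) , 0≤μ , 0≤ν , ≗-from-inject₁-fromℕ vertex last
    where
    λ′ : Fin n → ℚ
    λ′ t = y (inject₁ t) - degree μ t

    ν : ℚ
    ν = y (fromℕ n) - (sumFin λ′ + sumFin μ)

    Σλ′+Σμ : sumFin λ′ + sumFin μ ≡ sumFin (y ∘ inject₁) - sumFin μ
    Σλ′+Σμ = begin
      sumFin λ′ + sumFin μ
        ≡⟨ cong (_+ sumFin μ) (sumFin-- (y ∘ inject₁) (degree μ)) ⟩
      sumFin (y ∘ inject₁) - sumFin (degree μ) + sumFin μ
        ≡⟨ cong (λ z → sumFin (y ∘ inject₁) - z + sumFin μ) (sumFin-degree μ) ⟩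
      sumFin (y ∘ inject₁) - (sumFin μ + sumFin μ) + sumFin μ
        ≡⟨ solve 2 (λ a m → a :- (m :+ m) :+ m := a :- m) refl (sumFin (y ∘ inject₁)) (sumFin μ) ⟩
      sumFin (y ∘ inject₁) - sumFin μ ∎
      where open ≡-Reasoning

    0≤ν : 0ℚ ≤ℚ ν
    0≤ν = p≤q⇒0≤q-p (subst (_≤ℚ y (fromℕ n)) (sym Σλ′+Σμ) Σy-Σμ≤y)

    vertex : y ∘ inject₁ ≗ comb G λ′ μ ν ∘ inject₁
    vertex t = sym (trans (comb-inject₁ λ′ μ ν t)
                          (solve 2 (λ a d → a :- d :+ d := a) refl (y (inject₁ t)) (degree μ t)))

    last : y (fromℕ n) ≡ comb G λ′ μ ν (fromℕ n)
    last = sym (trans (comb-fromℕ λ′ μ ν)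
                      (solve 2 (λ s a → s :+ (a :- s) := a) refl
                             (sumFin λ′ + sumFin μ) (y (fromℕ n))))

  ball⊆cone : ∀ μ ε → (∀ k → 0ℚ ≤ℚ μ k) → (∀ t → 1ℚ ≤ℚ degree μ t) → 0ℚ ≤ℚ ε →
    ε * (1ℚ + (sumFin {n} (λ _ → 1ℚ) + sumFin μ)) ≡ 1ℚ →
    ∀ y → (∀ j → ∣ y j - comb G (λ _ → 0ℚ) μ 1ℚ j ∣ <ℚ ε) → InCone G y
  ball⊆cone μ ε 0≤μ 1≤degree 0≤ε ε[1+r]≡1 y near =
    inCone-fromEdgeWeights y (λ k → c * μ k) (λ k → *-nonneg 0≤c (0≤μ k)) vertex total
    where
    open ≤-Reasoning
    x : Vecℚ (suc n)
    x = comb G (λ _ → 0ℚ) μ 1ℚ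

    n′ c : ℚ
    n′ = sumFin {n} (λ _ → 1ℚ)
    c  = 1ℚ - ε

    0≤c : 0ℚ ≤ℚ c
    0≤c = begin
      0ℚ
        ≤⟨ *-nonneg 0≤ε (+-mono-≤ (0≤sumFin-1 n) (sumFin-nonneg 0≤μ)) ⟩
      ε * (n′ + sumFin μ)
        ≡⟨ solve 2 (λ ε r → ε :* r := ε :* (con 1ℚ :+ r) :- ε) refl ε (n′ + sumFin μ) ⟩
      ε * (1ℚ + (n′ + sumFin μ)) - ε
        ≡⟨ cong (_- ε) ε[1+r]≡1 ⟩
      c ∎

    x-inject₁ : ∀ t → x (inject₁ t) ≡ degree μ t
    x-inject₁ t = trans (comb-inject₁ (λ _ → 0ℚ) μ 1ℚ t) (+-identityˡ (degree μ t))

    x-fromℕ : x (fromℕ n) ≡ sumFin μ + 1ℚ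
    x-fromℕ = trans (comb-fromℕ (λ _ → 0ℚ) μ 1ℚ)
                    (cong (_+ 1ℚ) (trans (cong (_+ sumFin μ) (sumFin-0 n)) (+-identityˡ (sumFin μ))))

    vertex : ∀ t → degree (λ k → c * μ k) t ≤ℚ y (inject₁ t)
    vertex t = begin
      degree (λ k → c * μ k) t  ≡⟨ degree-*ˡ c μ t ⟩
      c * degree μ t            ≤⟨ [1-ε]*d≤d-ε 0≤ε (1≤degree t) ⟩
      degree μ t - ε            ≡⟨ cong (_- ε) (sym (x-inject₁ t)) ⟩
      x (inject₁ t) - ε         ≤⟨ ∣p-q∣<ε⇒q-ε≤p (near (inject₁ t)) ⟩
      y (inject₁ t)             ∎

    Σy≤ : sumFin (y ∘ inject₁) ≤ℚ sumFin μ + sumFin μ + ε * n′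
    Σy≤ = begin
      sumFin (y ∘ inject₁)
        ≤⟨ sumFin-mono (λ t → ∣p-q∣<ε⇒p≤q+ε (near (inject₁ t))) ⟩
      sumFin (λ t → x (inject₁ t) + ε)
        ≡⟨ sumFin-cong (λ t → cong (_+ ε) (x-inject₁ t)) ⟩
      sumFin (λ t → degree μ t + ε)
        ≡⟨ sumFin-+ (degree μ) (λ _ → ε) ⟩
      sumFin (degree μ) + sumFin {n} (λ _ → ε)
        ≡⟨ cong₂ _+_ (sumFin-degree μ) (sumFin-const {n} ε) ⟩
      sumFin μ + sumFin μ + ε * n′ ∎

    total : sumFin (y ∘ inject₁) - sumFin (λ k → c * μ k) ≤ℚ y (fromℕ n)
    total = begin
      sumFin (y ∘ inject₁) - sumFin (λ k → c * μ k)
        ≡⟨ cong (λ z → sumFin (y ∘ inject₁) - z) (sumFin-*ˡ c μ) ⟩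
      sumFin (y ∘ inject₁) - c * sumFin μ
        ≤⟨ +-monoˡ-≤ (- (c * sumFin μ)) Σy≤ ⟩
      sumFin μ + sumFin μ + ε * n′ - c * sumFin μ
        ≡⟨ solve 3 (λ m ε n′ → m :+ m :+ ε :* n′ :- (con 1ℚ :- ε) :* m
                               := m :+ ε :* (con 1ℚ :+ (n′ :+ m)) :- ε) refl (sumFin μ) ε n′ ⟩
      sumFin μ + ε * (1ℚ + (n′ + sumFin μ)) - ε
        ≡⟨ cong (λ z → sumFin μ + z - ε) ε[1+r]≡1 ⟩
      sumFin μ + 1ℚ - ε
        ≡⟨ cong (_- ε) (sym x-fromℕ) ⟩
      x (fromℕ n) - ε
        ≤⟨ ∣p-q∣<ε⇒q-ε≤p (near (fromℕ n)) ⟩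
      y (fromℕ n) ∎

  comb-interior : ∀ μ → (∀ k → 0ℚ ≤ℚ μ k) → (∀ t → 1ℚ ≤ℚ degree μ t) →
    InInterior G (comb G (λ _ → 0ℚ) μ 1ℚ)
  comb-interior μ 0≤μ 1≤degree =
    let ε , 0<ε , ε[1+r]≡1 = inverse-of-1+nonneg _ (+-mono-≤ (0≤sumFin-1 n) (sumFin-nonneg 0≤μ))
    in  ε , 0<ε , ball⊆cone μ ε 0≤μ 1≤degree (<⇒≤ 0<ε) ε[1+r]≡1

  Incident : Fin q → Fin n → Set
  Incident k t = proj₁ (ends G k) ≡ t ⊎ proj₂ (ends G k) ≡ t

  vchar-nonneg : ∀ k t → 0ℚ ≤ℚ vchar G k t
  vchar-nonneg k t = +-mono-≤ (e-nonneg (proj₁ (ends G k)) t) (e-nonneg (proj₂ (ends G k)) t)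

  1≤vchar : ∀ {k t} → Incident k t → 1ℚ ≤ℚ vchar G k t
  1≤vchar {k} {t} (inj₁ refl) =
    subst (λ z → z ≤ℚ vchar G k t) (e-diag t) (p≤p+q (e t t) (e-nonneg (proj₂ (ends G k)) t))
  1≤vchar {k} {t} (inj₂ refl) =
    subst (λ z → z ≤ℚ vchar G k t) (e-diag t)
      (subst (e t t ≤ℚ_) (+-comm (e t t) _) (p≤p+q (e t t) (e-nonneg (proj₁ (ends G k)) t)))

  1≤degree : ∀ {S k t} → lookup S k ≡ true → Incident k t → 1ℚ ≤ℚ degree (ℕtoℚ ∘ 𝟙 S) t
  1≤degree {S} {k} {t} k∈S k∋t = begin
    1ℚ                         ≤⟨ 1≤vchar k∋t ⟩
    vchar G k t                ≡⟨ sym (*-identityˡ (vchar G k t)) ⟩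
    1ℚ * vchar G k t           ≡⟨ cong (λ b → ℕtoℚ (if b then 1 else 0) * vchar G k t) (sym k∈S) ⟩
    ℕtoℚ (𝟙 S k) * vchar G k t ≤⟨ term≤sumFin 0≤terms k ⟩
    degree (ℕtoℚ ∘ 𝟙 S) t      ∎
    where
    open ≤-Reasoning
    0≤terms : ∀ l → 0ℚ ≤ℚ ℕtoℚ (𝟙 S l) * vchar G l t
    0≤terms l = *-nonneg (ℕtoℚ-nonneg (𝟙 S l)) (vchar-nonneg l t)

  walk-starts-along-edge : ∀ {S u v} → u ≢ v → Walk G S u v →
    ∃ λ k → lookup S k ≡ true × Incident k u
  walk-starts-along-edge u≢v here = ⊥-elim (u≢v refl)
  walk-starts-along-edge _ (step (k , k∈S , inj₁ (a≡u , _)) _) = k , k∈S , inj₁ a≡u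
  walk-starts-along-edge _ (step (k , k∈S , inj₂ (_ , b≡u)) _) = k , k∈S , inj₂ b≡u

  another-vertex : 1 ≤ q → ∀ t → Σ (Fin n) λ v → t ≢ v
  another-vertex (s≤s z≤n) t with t ≟ proj₁ (ends G zero)
  ... | yes t≡a = proj₂ (ends G zero) , λ t≡b → loopless G zero (trans (sym t≡a) t≡b)
  ... | no t≢a  = proj₁ (ends G zero) , t≢a

  connected⇒1≤degree : ∀ {S} → ConnectedOn G S → 1 ≤ q → ∀ t → 1ℚ ≤ℚ degree (ℕtoℚ ∘ 𝟙 S) t
  connected⇒1≤degree {S} connected 1≤q t =
    let v , t≢v = another-vertex 1≤q t
        k , k∈S , k∋t = walk-starts-along-edge t≢v (connected t v)
    in  1≤degree {S} k∈S k∋t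

eTilde-≗-comb : ∀ {n q} (G : Graph n q) S → eTilde G S ≗ comb G (λ _ → 0ℚ) (ℕtoℚ ∘ 𝟙 S) 1ℚ
eTilde-≗-comb {n} G S j = begin
  sumFin (λ k → if lookup S k then snoc (vchar G k) 1ℚ j else 0ℚ) + eLast n j
    ≡⟨ cong (_+ eLast n j)
            (sumFin-cong (λ k → if-then-else-0 (lookup S k) (snoc (vchar G k) 1ℚ j))) ⟩
  Σ𝟙v + eLast n j
    ≡⟨ cong₂ _+_ (sym (+-identityˡ Σ𝟙v)) (sym (*-identityˡ (eLast n j))) ⟩
  0ℚ + Σ𝟙v + 1ℚ * eLast n j
    ≡⟨ cong (λ z → z + Σ𝟙v + 1ℚ * eLast n j)
            (sym (trans (sumFin-cong (λ i → *-zeroˡ (snoc (e i) 1ℚ j))) (sumFin-0 n))) ⟩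
  comb G (λ _ → 0ℚ) (ℕtoℚ ∘ 𝟙 S) 1ℚ j ∎
  where
  open ≡-Reasoning
  Σ𝟙v : ℚ
  Σ𝟙v = sumFin (λ k → ℕtoℚ (𝟙 S k) * snoc (vchar G k) 1ℚ j)

proposition3p4 : ∀ {n q} (G : Graph n q) → Connected G → 1 ≤ q →
    (S : Subset q) → IsSpanningTree G S →
    InNB G (eTilde G S) × InInterior G (eTilde G S)
proposition3p4 G _ 1≤q S (T-connected , _) =
  ((λ _ → 0) , 𝟙 S , 1 , eTilde-≗-comb G S) ,
  interior-resp-≗ G (sym ∘ eTilde-≗-comb G S)
    (comb-interior G (ℕtoℚ ∘ 𝟙 S) (ℕtoℚ-nonneg ∘ 𝟙 S) (connected⇒1≤degree G T-connected 1≤q))
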